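{- Let $(G,T)\in\mathcal D_k$, and let $H,H'$ be graphs such that $\hom(F,H)=\hom(F,H')$ for all graphs $F$ of tree depth at most $k$ with $F\sqsubseteq_{\mathrm{col}} G$. Then $\mathrm{pi\text{ - }hom}((G,T),H)=\mathrm{pi\text{ - }hom}((G,T),H')$.
   Context: Graphs are finite, undirected, vertex-coloured triples $(V(G),E(G),\gamma^G)$. A homomorphism preserves edges and colours; $\hom$ counts homomorphisms. A forest is a finite poset $(V,\preceq)$ in which each $\{u:u\preceq t\}$ is a chain; a tree is a forest with a unique minimal element; height = maximum number of elements in a chain. An elimination forest (tree) of a graph $F$ is a forest (tree) on $V(F)$ with $u\preceq v$ or $v\preceq u$ for every edge $uv$. The tree depth of $F$ is the minimum height of an elimination forest of $F$. $\mathcal D_k$ is the class of pairs $(F,T)$ with $F$ a graph and $T$ an elimination tree of $F$ of height at most $k$. A homomorphism $g:(G,T)\to H$ (i.e. a homomorphism $G\to H$) is past-injective if $g(u)\ne g(v)$ whenever $u$ strictly precedes $v$ in $T$; $\mathrm{pi\text{ - }hom}((G,T),H)$ counts these. $F\sqsubseteq_{\mathrm{col}} G$ means $V(F)\subseteq V(G)$ and $\gamma^F(v)=\gamma^G(v)$ for all $v\in V(F)$ (no condition on edges). -}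

module Defs where

open import Data.Nat using (ℕ; zero; suc; _≤_; _≡ᵇ_)
open import Data.Bool using (Bool; true; false; not; _∧_; _∨_; if_then_else_)
open import Data.Fin using (Fin; zero; suc; _≟_)
open import Data.List using (List; []; _∷_; map; concatMap; length; allFin)
open import Data.List.Relation.Unary.All using (All)
open import Data.List.Relation.Unary.Unique.Propositional using (Unique)
open import Data.Product using (Σ; _×_; ∃; _,_)
open import Data.Sum using (_⊎_)
open import Relation.Nullary.Decidable using (⌊_⌋)
open import Relation.Binary.PropositionalEquality using (_≡_)
open import Function.Definitions using (Injective)

record Graph : Set where
  field
    n   : ℕ
    adj : Fin n → Fin n → Bool
    adj-sym  : ∀ u v → adj u v ≡ adj v u
    adj-irr  : ∀ u → adj u u ≡ false
    col : Fin n → ℕ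

open Graph public

cons : ∀ {n m} → Fin m → (Fin n → Fin m) → Fin (suc n) → Fin m
cons i f zero    = i
cons i f (suc j) = f j

allFuns : (n m : ℕ) → List (Fin n → Fin m)
allFuns zero    m = (λ ()) ∷ []
allFuns (suc n) m = concatMap (λ f → map (λ i → cons i f) (allFin m)) (allFuns n m)

allB : ∀ {A : Set} → (A → Bool) → List A → Bool
allB p []       = true
allB p (x ∷ xs) = p x ∧ allB p xs

count : ∀ {A : Set} → (A → Bool) → List A → ℕ
count p []       = 0
count p (x ∷ xs) = if p x then suc (count p xs) else count p xs

isHom : (F H : Graph) → (Fin (n F) → Fin (n H)) → Bool
isHom F H f =
  allB (λ u → (col F u ≡ᵇ col H (f u)) ∧
             allB (λ v → not (adj F u v) ∨ adj H (f u) (f v)) (allFin (n F)))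
      (allFin (n F))

hom : Graph → Graph → ℕ
hom F H = count (isHom F H) (allFuns (n F) (n H))

record Forest (n : ℕ) : Set where
  field
    le      : Fin n → Fin n → Bool
    refl    : ∀ u → le u u ≡ true
    antisym : ∀ u v → le u v ≡ true → le v u ≡ true → u ≡ v
    trans   : ∀ u v w → le u v ≡ true → le v w ≡ true → le u w ≡ true
    downChain : ∀ t u v → le u t ≡ true → le v t ≡ true →
                le u v ≡ true ⊎ le v u ≡ true

open Forest public

Comparable : ∀ {n} → Forest n → Fin n → Fin n → Set
Comparable T u v = le T u v ≡ true ⊎ le T v u ≡ true

IsChain : ∀ {n} → Forest n → List (Fin n) → Set
IsChain T c = Unique c × All (λ x → All (λ y → Comparable T x y) c) c

HeightLE : ∀ {n} → Forest n → ℕ → Set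
HeightLE {n} T k = (c : List (Fin n)) → IsChain T c → length c ≤ k

Minimal : ∀ {n} → Forest n → Fin n → Set
Minimal {n} T r = (v : Fin n) → le T v r ≡ true → v ≡ r

IsTree : ∀ {n} → Forest n → Set
IsTree {n} T = Σ (Fin n) λ r → Minimal T r × ((r' : Fin n) → Minimal T r' → r' ≡ r)

IsElimForest : (F : Graph) → Forest (n F) → Set
IsElimForest F T = ∀ u v → adj F u v ≡ true → Comparable T u v

TreeDepthLE : Graph → ℕ → Set
TreeDepthLE F k = Σ (Forest (n F)) λ T → IsElimForest F T × HeightLE T k

record InD (k : ℕ) (G : Graph) (T : Forest (n G)) : Set where
  field
    isTree   : IsTree T
    isElim   : IsElimForest G T
    heightLE : HeightLE T k

-- F ⊑col G : V(F) ⊆ V(G) with matching colours, realised by an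
-- injective inclusion map of vertex sets (no condition on edges).

_⊑col_ : Graph → Graph → Set
F ⊑col G = Σ (Fin (n F) → Fin (n G)) λ ι →
             Injective _≡_ _≡_ ι × (∀ v → col F v ≡ col G (ι v))

isPastInj : (G H : Graph) → Forest (n G) → (Fin (n G) → Fin (n H)) → Bool
isPastInj G H T g =
  allB (λ u → allB (λ v → not (le T u v ∧ not ⌊ u ≟ v ⌋) ∨ not ⌊ g u ≟ g v ⌋)
                 (allFin (n G)))
      (allFin (n G))

piHom : (G : Graph) → Forest (n G) → Graph → ℕ
piHom G T H = count (λ g → isHom G H g ∧ isPastInj G H T g) (allFuns (n G) (n H))

-- Count homomorphisms G → H subject to a list of constraints g x ≢ g y, each on a pair
-- that is comparable in the elimination forest T; past-injectivity is the list of all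
-- strictly comparable pairs. Dropping one constraint x ≢ y adds the maps with g x ≡ g y.
-- Their number is 0 if x, y are adjacent or differently coloured; otherwise, for x ≺ y,
-- it is the constrained count for the graph in which y is identified with x. That graph
-- has one vertex fewer, is still a coloured subgraph of G, and keeps an elimination forest
-- of height ≤ k (T without y): everything comparable with y is comparable with its
-- ancestor x, since downsets are chains. Induction on vertices, then on constraints, ends
-- at plain hom counts of graphs F ⊑col G of tree depth ≤ k, where H and H′ agree.

module Submission where

open import Defs hiding (refl; trans; antisym; downChain)
open import Data.Nat using (ℕ; zero; suc; _+_; _≤_; _≡ᵇ_)
open import Data.Nat.Properties
  using (+-identityʳ; +-assoc; +-suc; +-cancelʳ-≡; suc-injective; ≡ᵇ⇒≡; ≡⇒≡ᵇ;
         +-0-commutativeMonoid)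
  renaming (_≟_ to _≟ℕ_)
open import Data.Bool using (Bool; true; false; not; _∧_; _∨_; if_then_else_)
open import Data.Bool.Properties
  using (∨-comm; ∧-assoc; ∧-comm; ∧-identityʳ; ∧-zeroʳ; ∧-conicalˡ; ∧-conicalʳ; T-≡; ⇔→≡)
open import Data.Fin using (Fin; zero; suc; _≟_; punchIn; punchOut)
open import Data.Fin.Properties using (punchIn-injective; punchInᵢ≢i; punchIn-punchOut)
open import Data.List using (List; []; _∷_; _++_; map; concatMap; tabulate; allFin)
open import Data.List.Properties using (length-map)
open import Data.List.Relation.Unary.All as All using (All; []; _∷_; universal)
open import Data.List.Relation.Unary.All.Properties using (map⁺; concat⁺)
import Data.List.Relation.Unary.Unique.Propositional.Properties as Unique
open import Data.Product using (_×_; ∃; _,_; proj₁; proj₂)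
open import Data.Sum using (_⊎_; inj₁; inj₂; swap)
open import Function using (_∘_; id; _⇔_; mk⇔; Equivalence)
open import Function.Definitions using (Injective)
open import Relation.Nullary using (yes; no; contradiction)
open import Relation.Nullary.Decidable using (⌊_⌋; isYes≗does; dec-true; dec-false)
open import Relation.Binary.PropositionalEquality
open import Algebra.Properties.CommutativeMonoid.Sum +-0-commutativeMonoid
  using (sum; sum-syntax; sum-cong-≗; sum-remove; sum-replicate-zero; ∑-distrib-+)

open Equivalence using (to; from)

private
  variable
    A B : Set
    m k : ℕ

∨-true⁻ : ∀ {a b} → a ∨ b ≡ true → a ≡ true ⊎ b ≡ true
∨-true⁻ {true}  _ = inj₁ refl
∨-true⁻ {false} e = inj₂ e

∨-introˡ : ∀ {a b} → a ≡ true → a ∨ b ≡ true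
∨-introˡ refl = refl

∨-introʳ : ∀ a {b} → b ≡ true → a ∨ b ≡ true
∨-introʳ true  _ = refl
∨-introʳ false e = e

not-∨⇔ : ∀ {a b} → not a ∨ b ≡ true ⇔ (a ≡ true → b ≡ true)
not-∨⇔ {true}  = mk⇔ (λ e _ → e) (λ f → f refl)
not-∨⇔ {false} = mk⇔ (λ _ ()) (λ _ → refl)

⌊≟⌋-refl : (x : Fin m) → ⌊ x ≟ x ⌋ ≡ true
⌊≟⌋-refl x = trans (isYes≗does (x ≟ x)) (dec-true (x ≟ x) refl)

⌊≟⌋-≢ : {x y : Fin m} → x ≢ y → ⌊ x ≟ y ⌋ ≡ false
⌊≟⌋-≢ {x = x} {y} x≢y = trans (isYes≗does (x ≟ y)) (dec-false (x ≟ y) x≢y)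

⌊≟⌋-true : {x y : Fin m} → ⌊ x ≟ y ⌋ ≡ true → x ≡ y
⌊≟⌋-true {x = x} {y} e with x ≟ y
... | yes x≡y = x≡y

⌊≟⌋-sym : (x y : Fin m) → ⌊ x ≟ y ⌋ ≡ ⌊ y ≟ x ⌋
⌊≟⌋-sym x y with x ≟ y
... | yes refl = sym (⌊≟⌋-refl x)
... | no x≢y   = sym (⌊≟⌋-≢ (x≢y ∘ sym))

allB-tabulate⇔ : (p : A → Bool) (f : Fin m → A) →
                 allB p (tabulate f) ≡ true ⇔ (∀ i → p (f i) ≡ true)
allB-tabulate⇔ p f = mk⇔ (elim f) (intro f)
  where
  elim : ∀ {m} (f : Fin m → _) → allB p (tabulate f) ≡ true → ∀ i → p (f i) ≡ true
  elim f e zero    = ∧-conicalˡ _ _ e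
  elim f e (suc i) = elim (f ∘ suc) (∧-conicalʳ _ _ e) i
  intro : ∀ {m} (f : Fin m → _) → (∀ i → p (f i) ≡ true) → allB p (tabulate f) ≡ true
  intro {zero}  f h = refl
  intro {suc m} f h rewrite h zero = intro (f ∘ suc) (h ∘ suc)

allB-cong : {p q : A → Bool} (xs : List A) → (∀ x → p x ≡ q x) → allB p xs ≡ allB q xs
allB-cong []       e = refl
allB-cong (x ∷ xs) e = cong₂ _∧_ (e x) (allB-cong xs e)

allB-map : (p : B → Bool) (f : A → B) (xs : List A) → allB p (map f xs) ≡ allB (p ∘ f) xs
allB-map p f []       = refl
allB-map p f (x ∷ xs) = cong (p (f x) ∧_) (allB-map p f xs)

allB-++ : (p : A → Bool) (xs ys : List A) → allB p (xs ++ ys) ≡ allB p xs ∧ allB p ys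
allB-++ p []       ys = refl
allB-++ p (x ∷ xs) ys = trans (cong (p x ∧_) (allB-++ p xs ys)) (sym (∧-assoc (p x) _ _))

allB-concatMap : (p : B → Bool) (f : A → List B) (xs : List A) →
                 allB p (concatMap f xs) ≡ allB (λ x → allB p (f x)) xs
allB-concatMap p f []       = refl
allB-concatMap p f (x ∷ xs) =
  trans (allB-++ p (f x) (concatMap f xs)) (cong (allB p (f x) ∧_) (allB-concatMap p f xs))

indicator : Bool → ℕ
indicator true  = 1
indicator false = 0

count-cong : {p q : A → Bool} (xs : List A) → (∀ x → p x ≡ q x) → count p xs ≡ count q xs
count-cong []       e = refl
count-cong (x ∷ xs) e = cong₂ (λ b r → if b then suc r else r) (e x) (count-cong xs e)

count-none : {p : A → Bool} (xs : List A) → (∀ x → p x ≡ false) → count p xs ≡ 0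
count-none []       e = refl
count-none (x ∷ xs) e rewrite e x = count-none xs e

count-split : (p c : A → Bool) (xs : List A) →
              count p xs ≡ count (λ x → p x ∧ not (c x)) xs + count (λ x → p x ∧ c x) xs
count-split p c []       = refl
count-split p c (x ∷ xs) with p x | c x
... | true  | true  = trans (cong suc (count-split p c xs)) (sym (+-suc _ _))
... | true  | false = cong suc (count-split p c xs)
... | false | _     = count-split p c xs

listSum : List A → (A → ℕ) → ℕ
listSum []       h = 0
listSum (x ∷ xs) h = h x + listSum xs h

count≡listSum : (p : A → Bool) (xs : List A) → count p xs ≡ listSum xs (indicator ∘ p)
count≡listSum p []       = refl
count≡listSum p (x ∷ xs) with p x
... | true  = cong suc (count≡listSum p xs)
... | false = count≡listSum p xs

listSum-cong : {h h′ : A → ℕ} (xs : List A) → (∀ x → h x ≡ h′ x) →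
               listSum xs h ≡ listSum xs h′
listSum-cong []       e = refl
listSum-cong (x ∷ xs) e = cong₂ _+_ (e x) (listSum-cong xs e)

listSum-++ : (xs ys : List A) (h : A → ℕ) → listSum (xs ++ ys) h ≡ listSum xs h + listSum ys h
listSum-++ []       ys h = refl
listSum-++ (x ∷ xs) ys h = trans (cong (h x +_) (listSum-++ xs ys h)) (sym (+-assoc (h x) _ _))

listSum-concatMap : (f : A → List B) (xs : List A) (h : B → ℕ) →
                    listSum (concatMap f xs) h ≡ listSum xs (λ x → listSum (f x) h)
listSum-concatMap f []       h = refl
listSum-concatMap f (x ∷ xs) h =
  trans (listSum-++ (f x) (concatMap f xs) h) (cong (listSum (f x) h +_) (listSum-concatMap f xs h))

listSum-map : (f : A → B) (xs : List A) (h : B → ℕ) → listSum (map f xs) h ≡ listSum xs (h ∘ f)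
listSum-map f []       h = refl
listSum-map f (x ∷ xs) h = cong (h (f x) +_) (listSum-map f xs h)

listSum-tabulate : (f : Fin m → A) (h : A → ℕ) → listSum (tabulate f) h ≡ ∑[ i < m ] h (f i)
listSum-tabulate {zero}  f h = refl
listSum-tabulate {suc m} f h = cong (h (f zero) +_) (listSum-tabulate (f ∘ suc) h)

listSum-∑-comm : (xs : List A) (h : Fin k → A → ℕ) →
                 listSum xs (λ x → ∑[ i < k ] h i x) ≡ ∑[ i < k ] listSum xs (h i)
listSum-∑-comm {k = k} []       h = sym (sum-replicate-zero k)
listSum-∑-comm         (x ∷ xs) h =
  trans (cong (sum (λ i → h i x) +_) (listSum-∑-comm xs h))
        (sym (∑-distrib-+ (λ i → h i x) (λ i → listSum xs (h i))))

∑-indicator-≟ : (q : Fin k → Bool) (a : Fin k) →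
                ∑[ i < k ] indicator (q i ∧ ⌊ a ≟ i ⌋) ≡ indicator (q a)
∑-indicator-≟ {suc k} q a = begin
  sum t                             ≡⟨ sum-remove {i = a} t ⟩
  t a + sum (λ j → t (punchIn a j)) ≡⟨ cong₂ _+_ at-a elsewhere ⟩
  indicator (q a) + 0               ≡⟨ +-identityʳ _ ⟩
  indicator (q a)                   ∎
  where
  open ≡-Reasoning
  t : Fin (suc k) → ℕ
  t i = indicator (q i ∧ ⌊ a ≟ i ⌋)
  at-a : t a ≡ indicator (q a)
  at-a = cong indicator (trans (cong (q a ∧_) (⌊≟⌋-refl a)) (∧-identityʳ (q a)))
  elsewhere : sum (λ j → t (punchIn a j)) ≡ 0
  elsewhere = trans (sum-cong-≗ (λ j → cong indicator (trans
                       (cong (q (punchIn a j) ∧_) (⌊≟⌋-≢ (punchInᵢ≢i a j ∘ sym)))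
                       (∧-zeroʳ _))))
                    (sum-replicate-zero k)

cons-at : Fin (suc m) → Fin k → (Fin m → Fin k) → Fin (suc m) → Fin k
cons-at         zero    i f = cons i f
cons-at {suc m} (suc v) i f = cons (f zero) (cons-at v i (f ∘ suc))

cons-at-self : (v : Fin (suc m)) (i : Fin k) (f : Fin m → Fin k) → cons-at v i f v ≡ i
cons-at-self         zero    i f = refl
cons-at-self {suc m} (suc v) i f = cons-at-self v i (f ∘ suc)

cons-at-punchIn : (v : Fin (suc m)) (i : Fin k) (f : Fin m → Fin k) (x : Fin m) →
                  cons-at v i f (punchIn v x) ≡ f x
cons-at-punchIn         zero    i f x       = refl
cons-at-punchIn {suc m} (suc v) i f zero    = refl
cons-at-punchIn {suc m} (suc v) i f (suc x) = cons-at-punchIn v i (f ∘ suc) x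

listSum-allFuns-suc : ∀ m k (h : (Fin (suc m) → Fin k) → ℕ) →
                      listSum (allFuns (suc m) k) h ≡ listSum (allFuns m k) (λ f → ∑[ i < k ] h (cons i f))
listSum-allFuns-suc m k h =
  trans (listSum-concatMap _ (allFuns m k) h)
        (listSum-cong (allFuns m k) λ f →
          trans (listSum-map (λ i → cons i f) (allFin k) h) (listSum-tabulate id (h ∘ λ i → cons i f)))

listSum-allFuns-cons-at : ∀ m k (v : Fin (suc m)) (h : (Fin (suc m) → Fin k) → ℕ) →
                          listSum (allFuns (suc m) k) h ≡
                          listSum (allFuns m k) (λ f → ∑[ i < k ] h (cons-at v i f))
listSum-allFuns-cons-at m       k zero    h = listSum-allFuns-suc m k h
listSum-allFuns-cons-at (suc m) k (suc v) h = begin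
  listSum (allFuns (suc (suc m)) k) h
    ≡⟨ listSum-allFuns-suc (suc m) k h ⟩
  listSum (allFuns (suc m) k) (λ g → ∑[ j < k ] h (cons j g))
    ≡⟨ listSum-∑-comm (allFuns (suc m) k) (λ j g → h (cons j g)) ⟩
  ∑[ j < k ] listSum (allFuns (suc m) k) (λ g → h (cons j g))
    ≡⟨ sum-cong-≗ (λ j → listSum-allFuns-cons-at m k v (λ g → h (cons j g))) ⟩
  ∑[ j < k ] listSum (allFuns m k) (λ f → ∑[ i < k ] h (cons j (cons-at v i f)))
    ≡⟨ listSum-∑-comm (allFuns m k) (λ j f → ∑[ i < k ] h (cons j (cons-at v i f))) ⟨
  listSum (allFuns m k) (λ f → ∑[ j < k ] ∑[ i < k ] h (cons j (cons-at v i f)))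
    ≡⟨ listSum-allFuns-suc m k (λ f → ∑[ i < k ] h (cons-at (suc v) i f)) ⟨
  listSum (allFuns (suc m) k) (λ f → ∑[ i < k ] h (cons-at (suc v) i f))
    ∎
  where open ≡-Reasoning

-- A map g with g (punchIn v w) ≡ g v is determined by its restriction f = g ∘ punchIn v,
-- namely g = cons-at v (f w) f.
count-identify : (v : Fin (suc m)) (w : Fin m) (P : (Fin (suc m) → Fin k) → Bool) →
                 count (λ g → P g ∧ ⌊ g (punchIn v w) ≟ g v ⌋) (allFuns (suc m) k) ≡
                 count (λ f → P (cons-at v (f w) f)) (allFuns m k)
count-identify {m} {k} v w P = begin
  count (λ g → P g ∧ ⌊ g (punchIn v w) ≟ g v ⌋) (allFuns (suc m) k)
    ≡⟨ count≡listSum _ (allFuns (suc m) k) ⟩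
  listSum (allFuns (suc m) k) (λ g → indicator (P g ∧ ⌊ g (punchIn v w) ≟ g v ⌋))
    ≡⟨ listSum-allFuns-cons-at m k v _ ⟩
  listSum (allFuns m k)
          (λ f → ∑[ i < k ] indicator (P (extend f i) ∧ ⌊ extend f i (punchIn v w) ≟ extend f i v ⌋))
    ≡⟨ listSum-cong (allFuns m k) (λ f → sum-cong-≗ (λ i →
         cong (λ b → indicator (P (extend f i) ∧ b)) (cong₂ (λ x y → ⌊ x ≟ y ⌋)
           (cons-at-punchIn v i f w) (cons-at-self v i f)))) ⟩
  listSum (allFuns m k) (λ f → ∑[ i < k ] indicator (P (extend f i) ∧ ⌊ f w ≟ i ⌋))
    ≡⟨ listSum-cong (allFuns m k) (λ f → ∑-indicator-≟ (P ∘ extend f) (f w)) ⟩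
  listSum (allFuns m k) (λ f → indicator (P (extend f (f w))))
    ≡⟨ count≡listSum _ (allFuns m k) ⟨
  count (λ f → P (cons-at v (f w) f)) (allFuns m k)
    ∎
  where
  open ≡-Reasoning
  extend : (Fin m → Fin k) → Fin k → Fin (suc m) → Fin k
  extend f i = cons-at v i f

record IsHom (F H : Graph) (g : Fin (n F) → Fin (n H)) : Set where
  field
    col-preserving : ∀ u → col F u ≡ col H (g u)
    adj-preserving : ∀ u v → adj F u v ≡ true → adj H (g u) (g v) ≡ true

open IsHom

isHom⇔IsHom : (F H : Graph) (g : Fin (n F) → Fin (n H)) → isHom F H g ≡ true ⇔ IsHom F H g
isHom⇔IsHom F H g = mk⇔
  (λ e → record
    { col-preserving = λ u → ≡ᵇ-true⇔ .to (∧-conicalˡ _ _ (vertexwise e u))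
    ; adj-preserving = λ u v →
        not-∨⇔ .to (allB-tabulate⇔ _ id .to (∧-conicalʳ _ _ (vertexwise e u)) v)
    })
  (λ h → allB-tabulate⇔ _ id .from λ u →
    cong₂ _∧_ (≡ᵇ-true⇔ .from (col-preserving h u))
              (allB-tabulate⇔ _ id .from λ v → not-∨⇔ .from (adj-preserving h u v)))
  where
  vertexwise = allB-tabulate⇔ _ id .to
  ≡ᵇ-true⇔ : ∀ {a b} → (a ≡ᵇ b) ≡ true ⇔ a ≡ b
  ≡ᵇ-true⇔ {a} {b} = mk⇔ (≡ᵇ⇒≡ a b ∘ T-≡ .from) (T-≡ .to ∘ ≡⇒≡ᵇ a b)

-- (x , y , b) demands g x ≢ g y only when b is true, so that isPastInj is
-- satisfies (pastConstraints T) up to regrouping the conjunction.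
Constraint : ℕ → Set
Constraint m = Fin m × Fin m × Bool

separates : Constraint m → (Fin m → Fin k) → Bool
separates (x , y , b) g = not b ∨ not ⌊ g x ≟ g y ⌋

satisfies : List (Constraint m) → (Fin m → Fin k) → Bool
satisfies L g = allB (λ c → separates c g) L

homSat : (G : Graph) → List (Constraint (n G)) → Graph → ℕ
homSat G L H = count (λ g → isHom G H g ∧ satisfies L g) (allFuns (n G) (n H))

homSat≡ : (G : Graph) → List (Constraint (n G)) → Fin (n G) → Fin (n G) → Graph → ℕ
homSat≡ G L x y H =
  count (λ g → (isHom G H g ∧ satisfies L g) ∧ ⌊ g x ≟ g y ⌋) (allFuns (n G) (n H))

homSat-[] : (G H : Graph) → homSat G [] H ≡ hom G H
homSat-[] G H = count-cong (allFuns (n G) (n H)) (λ g → ∧-identityʳ (isHom G H g))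

homSat-split : (G : Graph) (L : List (Constraint (n G))) (x y : Fin (n G)) (H : Graph) →
               homSat G L H ≡ homSat G ((x , y , true) ∷ L) H + homSat≡ G L x y H
homSat-split G L x y H =
  trans (count-split _ (λ g → ⌊ g x ≟ g y ⌋) (allFuns (n G) (n H)))
        (cong (_+ homSat≡ G L x y H) (count-cong (allFuns (n G) (n H)) λ g →
          trans (∧-assoc (isHom G H g) _ _) (cong (isHom G H g ∧_) (∧-comm (satisfies L g) _))))

homSat-loop : (G : Graph) (L : List (Constraint (n G))) (x : Fin (n G)) (H : Graph) →
              homSat G ((x , x , true) ∷ L) H ≡ 0
homSat-loop G L x H = count-none (allFuns (n G) (n H)) λ g →
  trans (cong (λ b → isHom G H g ∧ (not b ∧ satisfies L g)) (⌊≟⌋-refl (g x))) (∧-zeroʳ _)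

homSat≡-sym : (G : Graph) (L : List (Constraint (n G))) (x y : Fin (n G)) (H : Graph) →
              homSat≡ G L x y H ≡ homSat≡ G L y x H
homSat≡-sym G L x y H = count-cong (allFuns (n G) (n H)) λ g → cong (_ ∧_) (⌊≟⌋-sym (g x) (g y))

homSat≡-none : (G : Graph) (L : List (Constraint (n G))) (x y : Fin (n G)) (H : Graph) →
               (∀ g → IsHom G H g → g x ≢ g y) → homSat≡ G L x y H ≡ 0
homSat≡-none G L x y H separated = count-none (allFuns (n G) (n H)) excluded
  where
  excluded : ∀ g → (isHom G H g ∧ satisfies L g) ∧ ⌊ g x ≟ g y ⌋ ≡ false
  excluded g with (isHom G H g ∧ satisfies L g) ∧ ⌊ g x ≟ g y ⌋ in e
  ... | false = refl
  ... | true  = contradiction (⌊≟⌋-true (∧-conicalʳ _ _ e))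
                  (separated g (isHom⇔IsHom G H g .to (∧-conicalˡ _ _ (∧-conicalˡ _ _ e))))

homSat≡-adjacent : (G : Graph) (L : List (Constraint (n G))) (x y : Fin (n G)) (H : Graph) →
                   adj G x y ≡ true → homSat≡ G L x y H ≡ 0
homSat≡-adjacent G L x y H xy = homSat≡-none G L x y H λ g h gx≡gy →
  contradiction (begin
    true              ≡⟨ adj-preserving h x y xy ⟨
    adj H (g x) (g y) ≡⟨ cong (λ z → adj H z (g y)) gx≡gy ⟩
    adj H (g y) (g y) ≡⟨ adj-irr H (g y) ⟩
    false             ∎) λ ()
  where open ≡-Reasoning

homSat≡-col : (G : Graph) (L : List (Constraint (n G))) (x y : Fin (n G)) (H : Graph) →
              col G x ≢ col G y → homSat≡ G L x y H ≡ 0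
homSat≡-col G L x y H cx≢cy = homSat≡-none G L x y H λ g h gx≡gy →
  cx≢cy (trans (col-preserving h x) (trans (cong (col H) gx≡gy) (sym (col-preserving h y))))

Comparable-≤ : ∀ {n} (T : Forest n) {u v z} → le T u v ≡ true → Comparable T v z → Comparable T u z
Comparable-≤ T uv (inj₁ vz) = inj₁ (Forest.trans T _ _ _ uv vz)
Comparable-≤ T uv (inj₂ zv) = Forest.downChain T _ _ _ uv zv

pullback : ∀ {n} (ι : Fin m → Fin n) → Injective _≡_ _≡_ ι → Forest n → Forest m
pullback ι ι-inj T = record
  { le        = λ x y → le T (ι x) (ι y)
  ; refl      = λ x → Forest.refl T (ι x)
  ; antisym   = λ x y xy yx → ι-inj (Forest.antisym T _ _ xy yx)
  ; trans     = λ x y z → Forest.trans T (ι x) (ι y) (ι z)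
  ; downChain = λ t x y → Forest.downChain T (ι t) (ι x) (ι y)
  }

pullback-heightLE : ∀ {n} (ι : Fin m → Fin n) (ι-inj : Injective _≡_ _≡_ ι) (T : Forest n) →
                    HeightLE T k → HeightLE (pullback ι ι-inj T) k
pullback-heightLE {k = k} ι ι-inj T height c (unique , comparable) =
  subst (_≤ k) (length-map ι c)
        (height (map ι c) (Unique.map⁺ ι-inj unique , map⁺ (All.map map⁺ comparable)))

ComparableIfActive : Forest m → Constraint m → Set
ComparableIfActive T (x , y , b) = b ≡ true → Comparable T x y

pastConstraints : Forest m → List (Constraint m)
pastConstraints {m} T =
  concatMap (λ x → map (λ y → x , y , le T x y ∧ not ⌊ x ≟ y ⌋) (allFin m)) (allFin m)

pastConstraints-comparable : (T : Forest m) → All (ComparableIfActive T) (pastConstraints T)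
pastConstraints-comparable {m} T =
  concat⁺ (map⁺ (universal (λ x → map⁺ (universal (λ y → inj₁ ∘ ∧-conicalˡ _ _) (allFin m)))
                           (allFin m)))

piHom≡homSat : (G : Graph) (T : Forest (n G)) (H : Graph) → piHom G T H ≡ homSat G (pastConstraints T) H
piHom≡homSat G T H = count-cong (allFuns (n G) (n H)) λ g → cong (isHom G H g ∧_) (sym
  (trans (allB-concatMap _ _ (allFin (n G)))
         (allB-cong (allFin (n G)) λ x → allB-map _ _ (allFin (n G)))))

-- Parametrised by the fields of G, so that its vertex type is literally Fin (suc m).
module Identify {m : ℕ} (a : Fin (suc m) → Fin (suc m) → Bool) (a-sym : ∀ x y → a x y ≡ a y x)
                (a-irr : ∀ x → a x x ≡ false) (c : Fin (suc m) → ℕ)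
                (v : Fin (suc m)) (w : Fin m) (u≁v : a (punchIn v w) v ≡ false) where

  G : Graph
  G = record { n = suc m ; adj = a ; adj-sym = a-sym ; adj-irr = a-irr ; col = c }

  u : Fin (suc m)
  u = punchIn v w

  -- The vertex v is deleted and u = punchIn v w (renamed w) inherits its edges.
  a′ : Fin m → Fin m → Bool
  a′ x y = a (punchIn v x) (punchIn v y)
         ∨ (⌊ x ≟ w ⌋ ∧ a v (punchIn v y))
         ∨ (⌊ y ≟ w ⌋ ∧ a (punchIn v x) v)

  a′-sym : ∀ x y → a′ x y ≡ a′ y x
  a′-sym x y = cong₂ _∨_ (a-sym _ _) (trans
    (cong₂ _∨_ (cong (⌊ x ≟ w ⌋ ∧_) (a-sym _ _)) (cong (⌊ y ≟ w ⌋ ∧_) (a-sym _ _)))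
    (∨-comm (⌊ x ≟ w ⌋ ∧ a (punchIn v y) v) (⌊ y ≟ w ⌋ ∧ a v (punchIn v x))))

  a′-irr : ∀ x → a′ x x ≡ false
  a′-irr x with x ≟ w
  ... | yes refl rewrite a-irr u | a-sym v u | u≁v = refl
  ... | no _     rewrite a-irr (punchIn v x) = refl

  G′ : Graph
  G′ = record { n = m ; adj = a′ ; adj-sym = a′-sym ; adj-irr = a′-irr ; col = c ∘ punchIn v }

  data _↦_ : Fin (suc m) → Fin m → Set where
    kept  : ∀ x → punchIn v x ↦ x
    moved : v ↦ w

  image : ∀ z → ∃ (z ↦_)
  image z with z ≟ v
  ... | yes refl = w , moved
  ... | no z≢v   = let x = punchOut (z≢v ∘ sym) in
                   x , subst (_↦ x) (punchIn-punchOut (z≢v ∘ sym)) (kept x)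

  data EdgeOver (x y : Fin m) : Set where
    edge : ∀ {z₁ z₂} → z₁ ↦ x → z₂ ↦ y → a z₁ z₂ ≡ true → EdgeOver x y

  a′-preimage : ∀ {x y} → a′ x y ≡ true → EdgeOver x y
  a′-preimage {x} {y} e with ∨-true⁻ {a (punchIn v x) (punchIn v y)} e
  ... | inj₁ e₁ = edge (kept x) (kept y) e₁
  ... | inj₂ e₂ with ∨-true⁻ {⌊ x ≟ w ⌋ ∧ a v (punchIn v y)} e₂
  ...   | inj₁ e₃ rewrite ⌊≟⌋-true {x = x} (∧-conicalˡ _ _ e₃) = edge moved (kept y) (∧-conicalʳ _ _ e₃)
  ...   | inj₂ e₃ rewrite ⌊≟⌋-true {x = y} (∧-conicalˡ _ _ e₃) = edge (kept x) moved (∧-conicalʳ _ _ e₃)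

  a′-image : ∀ {z₁ z₂ x y} → z₁ ↦ x → z₂ ↦ y → a z₁ z₂ ≡ true → a′ x y ≡ true
  a′-image (kept x) (kept y) e = ∨-introˡ e
  a′-image moved    (kept y) e =
    ∨-introʳ (a u (punchIn v y)) (∨-introˡ (trans (cong (_∧ a v (punchIn v y)) (⌊≟⌋-refl w)) e))
  a′-image (kept x) moved    e =
    ∨-introʳ (a (punchIn v x) u)
      (∨-introʳ (⌊ x ≟ w ⌋ ∧ a v u) (trans (cong (_∧ a (punchIn v x) v) (⌊≟⌋-refl w)) e))
  a′-image moved    moved    e = contradiction (trans (sym e) (a-irr v)) λ ()

  lift : ∀ {k} → (Fin m → Fin k) → Fin (suc m) → Fin k
  lift f = cons-at v (f w) f

  lift-over : ∀ {k} (f : Fin m → Fin k) {z x} → z ↦ x → lift f z ≡ f x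
  lift-over f (kept x) = cons-at-punchIn v (f w) f x
  lift-over f moved    = cons-at-self v (f w) f

  module _ (H : Graph) (f : Fin m → Fin (n H)) where

    private
      adj-lift : ∀ {z₁ z₂ x y} → z₁ ↦ x → z₂ ↦ y →
                 adj H (lift f z₁) (lift f z₂) ≡ adj H (f x) (f y)
      adj-lift over₁ over₂ = cong₂ (adj H) (lift-over f over₁) (lift-over f over₂)

    IsHom-descend : IsHom G H (lift f) → IsHom G′ H f
    IsHom-descend h = record
      { col-preserving = λ x → trans (col-preserving h (punchIn v x)) (cong (col H) (lift-over f (kept x)))
      ; adj-preserving = λ x y e → edge-image (a′-preimage e)
      }
      where
      edge-image : ∀ {x y} → EdgeOver x y → adj H (f x) (f y) ≡ true
      edge-image (edge over₁ over₂ e) = trans (sym (adj-lift over₁ over₂)) (adj-preserving h _ _ e)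

    IsHom-lift : c v ≡ c u → IsHom G′ H f → IsHom G H (lift f)
    IsHom-lift cv≡cu h = record
      { col-preserving = λ z → let over = proj₂ (image z) in
          trans (col-over over) (cong (col H) (sym (lift-over f over)))
      ; adj-preserving = λ z₁ z₂ e →
          let over₁ = proj₂ (image z₁) ; over₂ = proj₂ (image z₂) in
          trans (adj-lift over₁ over₂) (adj-preserving h _ _ (a′-image over₁ over₂ e))
      }
      where
      col-over : ∀ {z x} → z ↦ x → c z ≡ col H (f x)
      col-over (kept x) = col-preserving h x
      col-over moved    = trans cv≡cu (col-preserving h w)

    isHom-lift : c v ≡ c u → isHom G H (lift f) ≡ isHom G′ H f
    isHom-lift cv≡cu = ⇔→≡ (mk⇔
      (isHom⇔IsHom G′ H f .from ∘ IsHom-descend ∘ isHom⇔IsHom G H (lift f) .to)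
      (isHom⇔IsHom G H (lift f) .from ∘ IsHom-lift cv≡cu ∘ isHom⇔IsHom G′ H f .to))

  descend : Constraint (suc m) → Constraint m
  descend (x , y , b) = proj₁ (image x) , proj₁ (image y) , b

  satisfies-lift : ∀ {k} (f : Fin m → Fin k) L → satisfies L (lift f) ≡ satisfies (map descend L) f
  satisfies-lift f []              = refl
  satisfies-lift f ((x , y , b) ∷ L) = cong₂ _∧_
    (cong₂ (λ p q → not b ∨ not ⌊ p ≟ q ⌋)
           (lift-over f (proj₂ (image x))) (lift-over f (proj₂ (image y))))
    (satisfies-lift f L)

  homSat≡-identify : c v ≡ c u → ∀ L H → homSat≡ G L u v H ≡ homSat G′ (map descend L) H
  homSat≡-identify cv≡cu L H =
    trans (count-identify v w (λ g → isHom G H g ∧ satisfies L g))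
          (count-cong (allFuns m (n H)) λ f → cong₂ _∧_ (isHom-lift H f cv≡cu) (satisfies-lift f L))

  G′-⊑col : ∀ {G₀} → G ⊑col G₀ → G′ ⊑col G₀
  G′-⊑col (ι , ι-inj , ι-col) = ι ∘ punchIn v , punchIn-injective v _ _ ∘ ι-inj , ι-col ∘ punchIn v

  module _ (T : Forest (suc m)) (u≤v : le T u v ≡ true) where

    T′ : Forest m
    T′ = pullback (punchIn v) (punchIn-injective v _ _) T

    T′-heightLE : ∀ {k} → HeightLE T k → HeightLE T′ k
    T′-heightLE = pullback-heightLE (punchIn v) (punchIn-injective v _ _) T

    Comparable-over : ∀ {z₁ z₂ x y} → z₁ ↦ x → z₂ ↦ y → Comparable T z₁ z₂ → Comparable T′ x y
    Comparable-over (kept x) (kept y) cmp = cmp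
    Comparable-over (kept x) moved    cmp = swap (Comparable-≤ T u≤v (swap cmp))
    Comparable-over moved    (kept y) cmp = Comparable-≤ T u≤v cmp
    Comparable-over moved    moved    cmp = inj₁ (Forest.refl T u)

    T′-elim : IsElimForest G T → IsElimForest G′ T′
    T′-elim elim x y e with a′-preimage e
    ... | edge over₁ over₂ e′ = Comparable-over over₁ over₂ (elim _ _ e′)

    descend-comparable : ∀ {L} → All (ComparableIfActive T) L →
                         All (ComparableIfActive T′) (map descend L)
    descend-comparable []                             = []
    descend-comparable {(x , y , b) ∷ L} (cmp ∷ cmps) =
      (Comparable-over (proj₂ (image x)) (proj₂ (image y)) ∘ cmp) ∷ descend-comparable cmps

module _ (k : ℕ) (G₀ H H′ : Graph)
         (hom-agree : (F : Graph) → TreeDepthLE F k → F ⊑col G₀ → hom F H ≡ hom F H′) where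

  Agrees : Graph → Set
  Agrees G = (T : Forest (n G)) → IsElimForest G T → HeightLE T k → G ⊑col G₀ →
             (L : List (Constraint (n G))) → All (ComparableIfActive T) L →
             homSat G L H ≡ homSat G L H′

  private
    both-zero : ∀ {p q : ℕ} → p ≡ 0 → q ≡ 0 → p ≡ q
    both-zero p≡0 q≡0 = trans p≡0 (sym q≡0)

  homSat≡-agrees : (G : Graph) → (∀ G′ → suc (n G′) ≡ n G → Agrees G′) →
                   (T : Forest (n G)) → IsElimForest G T → HeightLE T k → G ⊑col G₀ →
                   (L : List (Constraint (n G))) → All (ComparableIfActive T) L →
                   ∀ x y → le T x y ≡ true → x ≢ y → homSat≡ G L x y H ≡ homSat≡ G L x y H′
  homSat≡-agrees G@record { n = suc m ; adj = a ; adj-sym = a-sym ; adj-irr = a-irr ; col = c }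
                 smaller T elim height sub L cmps x v x≤v x≢v
    with punchOut (x≢v ∘ sym) | punchIn-punchOut (x≢v ∘ sym)
  ... | w | refl with a (punchIn v w) v in u~v | c (punchIn v w) ≟ℕ c v
  ...   | true  | _         =
    both-zero (homSat≡-adjacent G L _ v H u~v) (homSat≡-adjacent G L _ v H′ u~v)
  ...   | false | no  cu≢cv =
    both-zero (homSat≡-col G L _ v H cu≢cv) (homSat≡-col G L _ v H′ cu≢cv)
  ...   | false | yes cu≡cv = begin
    homSat≡ G L u v H              ≡⟨ homSat≡-identify (sym cu≡cv) L H ⟩
    homSat G′ (map descend L) H    ≡⟨ smaller G′ refl (T′ T x≤v) (T′-elim T x≤v elim)
                                        (T′-heightLE T x≤v height) (G′-⊑col {G₀} sub)
                                        (map descend L) (descend-comparable T x≤v cmps) ⟩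
    homSat G′ (map descend L) H′   ≡⟨ homSat≡-identify (sym cu≡cv) L H′ ⟨
    homSat≡ G L u v H′             ∎
    where
    open ≡-Reasoning
    open Identify a a-sym a-irr c v w u~v hiding (G)

  agrees-from-smaller : (G : Graph) → (∀ G′ → suc (n G′) ≡ n G → Agrees G′) → Agrees G
  agrees-from-smaller G smaller T elim height sub = go
    where
    go : (L : List (Constraint (n G))) → All (ComparableIfActive T) L → homSat G L H ≡ homSat G L H′
    go [] [] = begin
      homSat G [] H  ≡⟨ homSat-[] G H ⟩
      hom G H        ≡⟨ hom-agree G (T , elim , height) sub ⟩
      hom G H′       ≡⟨ homSat-[] G H′ ⟨
      homSat G [] H′ ∎
      where open ≡-Reasoning
    go ((x , y , false) ∷ L) (_ ∷ cmps) = go L cmps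
    go ((x , y , true) ∷ L) (cmp ∷ cmps) with x ≟ y
    ... | yes refl = both-zero (homSat-loop G L x H) (homSat-loop G L x H′)
    ... | no x≢y = +-cancelʳ-≡ _ _ _ (begin
      homSat G L′ H + homSat≡ G L x y H    ≡⟨ homSat-split G L x y H ⟨
      homSat G L H                         ≡⟨ go L cmps ⟩
      homSat G L H′                        ≡⟨ homSat-split G L x y H′ ⟩
      homSat G L′ H′ + homSat≡ G L x y H′  ≡⟨ cong (homSat G L′ H′ +_) identified ⟨
      homSat G L′ H′ + homSat≡ G L x y H   ∎)
      where
      open ≡-Reasoning
      L′ = (x , y , true) ∷ L
      identified : homSat≡ G L x y H ≡ homSat≡ G L x y H′
      identified with cmp refl
      ... | inj₁ x≤y = homSat≡-agrees G smaller T elim height sub L cmps x y x≤y x≢y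
      ... | inj₂ y≤x = begin
        homSat≡ G L x y H   ≡⟨ homSat≡-sym G L x y H ⟩
        homSat≡ G L y x H   ≡⟨ homSat≡-agrees G smaller T elim height sub L cmps
                                                 y x y≤x (x≢y ∘ sym) ⟩
        homSat≡ G L y x H′  ≡⟨ homSat≡-sym G L x y H′ ⟨
        homSat≡ G L x y H′  ∎

  agrees : ∀ m (G : Graph) → n G ≡ m → Agrees G
  agrees zero    G n≡0 = agrees-from-smaller G λ G′ e → contradiction (trans e n≡0) λ ()
  agrees (suc m) G n≡m = agrees-from-smaller G λ G′ e → agrees m G′ (suc-injective (trans e n≡m))

lemma10 : (k : ℕ) (G : Graph) (T : Forest (n G)) → InD k G T →
          (H H' : Graph) →
          ((F : Graph) → TreeDepthLE F k → F ⊑col G → hom F H ≡ hom F H') →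
          piHom G T H ≡ piHom G T H'
lemma10 k G T G∈𝒟 H H′ hom-agree = begin
  piHom G T H                      ≡⟨ piHom≡homSat G T H ⟩
  homSat G (pastConstraints T) H   ≡⟨ agrees k G H H′ hom-agree (n G) G refl T
                                        (InD.isElim G∈𝒟) (InD.heightLE G∈𝒟) (id , id , λ _ → refl)
                                        (pastConstraints T) (pastConstraints-comparable T) ⟩
  homSat G (pastConstraints T) H′  ≡⟨ piHom≡homSat G T H′ ⟨
  piHom G T H′                     ∎
  where open ≡-Reasoning
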